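{- Let $G$ be a finite graph without loops with vertices $v_0, \ldots, v_n$, let $D$ be a divisor of degree $d$ on $G$, and let $r$ be an integer with $0 \leq r \leq d$. Then $D$ has rank at least $r$ if and only if \[ (D - d v_0) - r\mathcal{A}(G) \subseteq (d-r)\mathcal{A}(G) \] in $\operatorname{Jac}(G)$.
   Context: A divisor is an integer combination $\sum a_i v_i$ of vertices; degree $\sum a_i$; effective if all $a_i\ge 0$. With $\Delta$ the Laplacian ($\Delta_{ii}=\operatorname{val}(v_i)$, $\Delta_{ij}=-$number of edges between $v_i,v_j$), divisors are equivalent if their difference lies in $\Delta\mathbb{Z}^{n+1}$; $\operatorname{Jac}(G)$ is the group of equivalence classes of degree-zero divisors. The rank of $D$ is $-1$ if $D$ is not equivalent to an effective divisor, and otherwise the largest $r$ such that $D-E$ is equivalent to an effective divisor for every effective $E$ of degree $r$. $\mathcal{A}(G) = \{[v_i - v_0] \mid 0\le i\le n\} \subseteq \operatorname{Jac}(G)$. For $m\ge1$, $m\mathcal{A}(G)$ is the set of sums of $m$ elements of $\mathcal{A}(G)$, and $0\mathcal{A}(G)=\{0\}$; for a class $x$, $x - r\mathcal{A}(G) = \{x - a \mid a \in r\mathcal{A}(G)\}$. -}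

module Defs where

open import Data.Nat as ℕ using (ℕ; zero; suc; _≤_)
open import Data.Integer as ℤ using (ℤ; +_; _+_; _-_; _*_; -_)
open import Data.Fin using (Fin; zero; suc; _≟_)
open import Data.Vec using (Vec; []; _∷_)
open import Data.Product using (Σ; ∃; _×_; _,_)
open import Relation.Nullary using (¬_; yes; no)
open import Relation.Binary.PropositionalEquality using (_≡_)

record Graph (n : ℕ) : Set where
  field
    edges    : Fin (suc n) → Fin (suc n) → ℕ
    symmetric : ∀ i j → edges i j ≡ edges j i
    loopless  : ∀ i → edges i i ≡ 0

Σℤ : ∀ {m} → (Fin m → ℤ) → ℤ
Σℤ {zero}  f = + 0
Σℤ {suc m} f = f zero + Σℤ (λ i → f (suc i))

Divisor : ℕ → Set
Divisor n = Fin (suc n) → ℤ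

deg : ∀ {n} → Divisor n → ℤ
deg D = Σℤ D

Effective : ∀ {n} → Divisor n → Set
Effective D = ∀ i → + 0 ℤ.≤ D i

module _ {n : ℕ} (G : Graph n) where
  open Graph G

  val : Fin (suc n) → ℕ
  val i = ℤ.∣ Σℤ (λ j → + edges i j) ∣

  Laplacian : Fin (suc n) → Fin (suc n) → ℤ
  Laplacian i j with i ≟ j
  ... | yes _ = + val i
  ... | no  _ = - (+ edges i j)

  applyΔ : (Fin (suc n) → ℤ) → Divisor n
  applyΔ z i = Σℤ (λ j → Laplacian i j * z j)

  _∼_ : Divisor n → Divisor n → Set
  D ∼ D' = ∃ λ (z : Fin (suc n) → ℤ) → ∀ i → D i - D' i ≡ applyΔ z i

  RankProperty : Divisor n → ℕ → Set
  RankProperty D s = ∀ (E : Divisor n) → Effective E → deg E ≡ + s →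
                     ∃ λ (F : Divisor n) → Effective F × ((λ i → D i - E i) ∼ F)

  -- rank D ≥ r (for r ≥ 0): D is equivalent to an effective divisor and the
  -- largest s with RankProperty D s is at least r.
  RankAtLeast : Divisor n → ℕ → Set
  RankAtLeast D r = ∃ λ (s : ℕ) → r ≤ s × RankProperty D s

point : ∀ {n} → Fin (suc n) → Divisor n
point i j with i ≟ j
... | yes _ = + 1
... | no  _ = + 0

_⊕_ : ∀ {n} → Divisor n → Divisor n → Divisor n
(D ⊕ D') i = D i + D' i

_⊖_ : ∀ {n} → Divisor n → Divisor n → Divisor n
(D ⊖ D') i = D i - D' i

zeroDiv : ∀ {n} → Divisor n
zeroDiv _ = + 0

scale : ∀ {n} → ℤ → Divisor n → Divisor n
scale k D i = k * D i

-- representative of the sum of m elements of 𝒜(G):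
-- Σ_k (v_{i_k} - v_0) for a list (i_1,…,i_m) of vertices
sumA : ∀ {n m} → Vec (Fin (suc n)) m → Divisor n
sumA []       = zeroDiv
sumA (i ∷ is) = (point i ⊖ point zero) ⊕ sumA is

module _ {n : ℕ} (G : Graph n) where
  -- In Jac(G):  x − r𝒜(G) ⊆ m𝒜(G), where x is the class of the degree-zero divisor X.
  -- Classes are represented by divisors, membership by linear equivalence.
  MinusSubset : Divisor n → ℕ → ℕ → Set
  MinusSubset X r m = ∀ (as : Vec (Fin (suc n)) r) →
    ∃ λ (bs : Vec (Fin (suc n)) m) → _∼_ G (X ⊖ sumA as) (sumA bs)

{-# OPTIONS --safe #-}
module Submission where

-- An effective divisor of degree k is a sum v_{a₁} + … + v_{a_k} of vertices, and then
-- Σ (v_{a_j} − v₀) represents an element of k𝒜(G). For E = Σ v_a of degree r and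
-- F = Σ v_b of degree d − r, subtracting d·v₀ = r·v₀ + (d − r)·v₀ turns D − E ∼ F into
-- (D − d v₀) − Σ (v_a − v₀) ∼ Σ (v_b − v₀). The columns of the Laplacian sum to zero, so
-- linear equivalence preserves degree: every effective divisor equivalent to D − E has
-- degree d − r and is such a sum F. Finally, "D − E is equivalent to an effective divisor
-- for every effective E of degree s" passes to all smaller s (pad E with copies of v₀),
-- so rank D ≥ r is exactly this property for s = r.

open import Defs
open import Data.Nat using (ℕ; _≤_; _∸_)
open import Data.Integer using (+_)
open import Data.Fin using (zero)
open import Relation.Binary.PropositionalEquality using (_≡_)
open import Function.Bundles using (_⇔_)

open import Data.Fin using (Fin; suc; _≟_)
open import Data.Fin.Properties using (all?; ¬∀⟶∃¬)
open import Data.Integer as ℤ using (ℤ; 0ℤ; -1ℤ; +≤+; _+_; _-_; _*_; -_)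
import Data.Integer.Properties as ℤ
open import Data.Integer.Tactic.RingSolver using (solve-∀)
open import Data.Nat as ℕ using (z≤n)
import Data.Nat.Properties as ℕ
open import Data.Product using (∃; _,_)
open import Data.Sum using (_⊎_; inj₁; inj₂)
open import Data.Vec using (Vec; []; _∷_; replicate)
open import Function using (_∘_)
open import Function.Bundles using (mk⇔; Equivalence)
open import Function.Construct.Composition using (_⇔-∘_)
open import Relation.Nullary using (yes; no; contradiction)
open import Relation.Binary.PropositionalEquality
  using (_≢_; _≗_; refl; sym; trans; cong; cong₂; module ≡-Reasoning)
open import Algebra.Properties.Semiring.Sum ℤ.+-*-semiring
  using (sum; sum-cong-≗; sum-replicate-zero; ∑-distrib-+; ∑-comm; *-distribˡ-sum; *-distribʳ-sum)

open ≡-Reasoning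

Σℤ≗sum : ∀ {m} (f : Fin m → ℤ) → Σℤ f ≡ sum f
Σℤ≗sum {ℕ.zero}  f = refl
Σℤ≗sum {ℕ.suc m} f = cong (_+_ (f zero)) (Σℤ≗sum (f ∘ suc))

sum-nonneg : ∀ {m} {f : Fin m → ℤ} → (∀ i → 0ℤ ℤ.≤ f i) → 0ℤ ℤ.≤ sum f
sum-nonneg {ℕ.zero}  f≥0 = +≤+ z≤n
sum-nonneg {ℕ.suc m} f≥0 = ℤ.+-mono-≤ (f≥0 zero) (sum-nonneg (f≥0 ∘ suc))

neg-distrib-sum : ∀ {m} (f : Fin m → ℤ) → - sum f ≡ sum (λ i → - f i)
neg-distrib-sum f = begin
  - sum f                ≡⟨ ℤ.-1*i≡-i (sum f) ⟨
  -1ℤ * sum f            ≡⟨ *-distribˡ-sum -1ℤ f ⟩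
  sum (λ i → -1ℤ * f i)  ≡⟨ sum-cong-≗ (ℤ.-1*i≡-i ∘ f) ⟩
  sum (λ i → - f i)      ∎

∑-distrib-- : ∀ {m} (f g : Fin m → ℤ) → sum (λ i → f i - g i) ≡ sum f - sum g
∑-distrib-- f g = trans (∑-distrib-+ f (-_ ∘ g)) (cong (_+_ (sum f)) (sym (neg-distrib-sum g)))

deg-cong : ∀ {n} {D D′ : Divisor n} → D ≗ D′ → deg D ≡ deg D′
deg-cong {D = D} {D′} D≗D′ = trans (Σℤ≗sum D) (trans (sum-cong-≗ D≗D′) (sym (Σℤ≗sum D′)))

deg-zero : ∀ {n} {E : Divisor n} → E ≗ zeroDiv → deg E ≡ 0ℤ
deg-zero {n} {E} E≗0 = trans (Σℤ≗sum E) (trans (sum-cong-≗ E≗0) (sum-replicate-zero (ℕ.suc n)))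

deg-⊕ : ∀ {n} (D D′ : Divisor n) → deg (D ⊕ D′) ≡ deg D + deg D′
deg-⊕ D D′ = begin
  deg (D ⊕ D′)     ≡⟨ Σℤ≗sum (D ⊕ D′) ⟩
  sum (D ⊕ D′)     ≡⟨ ∑-distrib-+ D D′ ⟩
  sum D + sum D′   ≡⟨ cong₂ _+_ (Σℤ≗sum D) (Σℤ≗sum D′) ⟨
  deg D + deg D′   ∎

deg-⊖ : ∀ {n} (D D′ : Divisor n) → deg (D ⊖ D′) ≡ deg D - deg D′
deg-⊖ D D′ = begin
  deg (D ⊖ D′)     ≡⟨ Σℤ≗sum (D ⊖ D′) ⟩
  sum (D ⊖ D′)     ≡⟨ ∑-distrib-- D D′ ⟩
  sum D - sum D′   ≡⟨ cong₂ _-_ (Σℤ≗sum D) (Σℤ≗sum D′) ⟨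
  deg D - deg D′   ∎

deg-nonneg : ∀ {n} {E : Divisor n} → Effective E → 0ℤ ℤ.≤ deg E
deg-nonneg {E = E} E≥0 = ℤ.≤-trans (sum-nonneg E≥0) (ℤ.≤-reflexive (sym (Σℤ≗sum E)))

⊕-effective : ∀ {n} {D D′ : Divisor n} → Effective D → Effective D′ → Effective (D ⊕ D′)
⊕-effective D≥0 D′≥0 i = ℤ.+-mono-≤ (D≥0 i) (D′≥0 i)

point-self : ∀ {n} (i : Fin (ℕ.suc n)) → point i i ≡ + 1
point-self i with i ≟ i
... | yes _  = refl
... | no i≢i = contradiction refl i≢i

point-other : ∀ {n} {i j : Fin (ℕ.suc n)} → i ≢ j → point i j ≡ 0ℤ
point-other {i = i} {j} i≢j with i ≟ j
... | yes i≡j = contradiction i≡j i≢j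
... | no _    = refl

point-suc : ∀ {n} (i j : Fin (ℕ.suc n)) → point (suc i) (suc j) ≡ point i j
point-suc i j with i ≟ j
... | yes refl = refl
... | no _     = refl

point-effective : ∀ {n} (i : Fin (ℕ.suc n)) → Effective (point i)
point-effective i j with i ≟ j
... | yes _ = +≤+ z≤n
... | no _  = +≤+ z≤n

sum-point : ∀ {n} (i : Fin (ℕ.suc n)) → sum (point i) ≡ + 1
sum-point {n}       zero    = cong (_+_ (+ 1)) (sum-replicate-zero n)
sum-point {ℕ.suc _} (suc i) = trans (ℤ.+-identityˡ _) (trans (sum-cong-≗ (point-suc i)) (sum-point i))

deg-point : ∀ {n} (i : Fin (ℕ.suc n)) → deg (point i) ≡ + 1
deg-point i = trans (Σℤ≗sum (point i)) (sum-point i)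

deg-⊖-point : ∀ {n} {E : Divisor n} {k} i → deg E ≡ + k → deg (E ⊖ point i) ≡ + k - + 1
deg-⊖-point {E = E} i degE = trans (deg-⊖ E (point i)) (cong₂ _-_ degE (deg-point i))

⊖-point-effective : ∀ {n} {E : Divisor n} {i} → Effective E → E i ≢ 0ℤ → Effective (E ⊖ point i)
⊖-point-effective {E = E} {i} E≥0 Ei≢0 j with i ≟ j
... | yes refl = ℤ.i≤j⇒0≤j-i (ℤ.i<j⇒suc[i]≤j (ℤ.≤∧≢⇒< (E≥0 i) (Ei≢0 ∘ sym)))
... | no _     = ℤ.i≤j⇒0≤j-i (E≥0 j)

effective-zero-or-⊖-point : ∀ {n} {E : Divisor n} → Effective E →
                            E ≗ zeroDiv ⊎ ∃ λ i → Effective (E ⊖ point i)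
effective-zero-or-⊖-point {E = E} E≥0 with all? (λ i → E i ℤ.≟ 0ℤ)
... | yes E≗0 = inj₁ E≗0
... | no E≉0  = let (i , Ei≢0) = ¬∀⟶∃¬ _ _ (λ i → E i ℤ.≟ 0ℤ) E≉0
                in  inj₂ (i , ⊖-point-effective E≥0 Ei≢0)

sumPoints : ∀ {n k} → Vec (Fin (ℕ.suc n)) k → Divisor n
sumPoints []       = zeroDiv
sumPoints (i ∷ is) = point i ⊕ sumPoints is

sumPoints-effective : ∀ {n k} (is : Vec (Fin (ℕ.suc n)) k) → Effective (sumPoints is)
sumPoints-effective []       _ = +≤+ z≤n
sumPoints-effective (i ∷ is)   = ⊕-effective (point-effective i) (sumPoints-effective is)

deg-sumPoints : ∀ {n k} (is : Vec (Fin (ℕ.suc n)) k) → deg (sumPoints is) ≡ + k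
deg-sumPoints {n} []   = deg-zero {n} (λ _ → refl)
deg-sumPoints (i ∷ is) =
  trans (deg-⊕ (point i) (sumPoints is)) (cong₂ _+_ (deg-point i) (deg-sumPoints is))

effective⇒sumPoints : ∀ {n} k {E : Divisor n} → Effective E → deg E ≡ + k →
                      ∃ λ (is : Vec (Fin (ℕ.suc n)) k) → E ≗ sumPoints is
effective⇒sumPoints k E≥0 degE with effective-zero-or-⊖-point E≥0
effective⇒sumPoints ℕ.zero        _ _    | inj₁ E≗0 = [] , E≗0
effective⇒sumPoints (ℕ.suc k)     _ degE | inj₁ E≗0 =
  contradiction (trans (sym degE) (deg-zero E≗0)) λ ()
effective⇒sumPoints ℕ.zero    {E} _ degE | inj₂ (i , E-i≥0) =
  contradiction (ℤ.≤-trans (deg-nonneg E-i≥0) (ℤ.≤-reflexive (deg-⊖-point {E = E} i degE))) λ ()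
effective⇒sumPoints (ℕ.suc k) {E} _ degE | inj₂ (i , E-i≥0) =
  let (is , E-i≗is) = effective⇒sumPoints k E-i≥0 (deg-⊖-point {E = E} i degE)
  in  i ∷ is , λ j → trans (restore (E j) (point i j)) (cong (_+_ (point i j)) (E-i≗is j))
  where
  restore : ∀ e p → e ≡ p + (e - p)
  restore = solve-∀

sumA≗sumPoints : ∀ {n k} (is : Vec (Fin (ℕ.suc n)) k) →
                 sumA is ≗ sumPoints is ⊖ scale (+ k) (point zero)
sumA≗sumPoints []       j = refl
sumA≗sumPoints {k = ℕ.suc k} (i ∷ is) j =
  trans (cong (_+_ (point i j - point zero j)) (sumA≗sumPoints is j))
        (telescope (point i j) (sumPoints is j) (point zero j) (+ k))
  where
  telescope : ∀ p s o k → p - o + (s - k * o) ≡ p + s - (+ 1 + k) * o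
  telescope = solve-∀

sumA-difference : ∀ {n r m d} (D : Divisor n)
                  (as : Vec (Fin (ℕ.suc n)) r) (bs : Vec (Fin (ℕ.suc n)) m) → r ℕ.+ m ≡ d → ∀ i →
                  (D ⊖ sumPoints as) i - sumPoints bs i ≡
                  ((D ⊖ scale (+ d) (point zero)) ⊖ sumA as) i - sumA bs i
sumA-difference {r = r} {m} D as bs refl i = begin
  D i - a - b
    ≡⟨ cancel (D i) a b o (+ r) (+ m) ⟨
  D i - (+ r + + m) * o - (a - + r * o) - (b - + m * o)
    ≡⟨ cong (λ c → D i - c * o - (a - + r * o) - (b - + m * o)) (ℤ.pos-+ r m) ⟨
  D i - + (r ℕ.+ m) * o - (a - + r * o) - (b - + m * o)
    ≡⟨ cong₂ (λ x y → D i - + (r ℕ.+ m) * o - x - y)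
             (sumA≗sumPoints as i) (sumA≗sumPoints bs i) ⟨
  D i - + (r ℕ.+ m) * o - sumA as i - sumA bs i ∎
  where
  o a b : ℤ
  o = point zero i
  a = sumPoints as i
  b = sumPoints bs i
  cancel : ∀ x a b o r m → x - (r + m) * o - (a - r * o) - (b - m * o) ≡ x - a - b
  cancel = solve-∀

module _ {n : ℕ} (G : Graph n) where
  open Graph G

  ∼-resp-⊖ : ∀ (A B A′ B′ : Divisor n) → (∀ i → A i - B i ≡ A′ i - B′ i) →
             _∼_ G A B → _∼_ G A′ B′
  ∼-resp-⊖ _ _ _ _ A-B≡A′-B′ (z , A-B≡Δz) =
    z , λ i → trans (sym (A-B≡A′-B′ i)) (A-B≡Δz i)

  Laplacian≡point*val-edges : ∀ i j → Laplacian G i j ≡ point j i * + val G j - + edges i j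
  Laplacian≡point*val-edges i j with i ≟ j
  ... | yes refl rewrite point-self i | loopless i =
    sym (trans (ℤ.+-identityʳ (+ 1 * + val G i)) (ℤ.*-identityˡ (+ val G i)))
  ... | no i≢j   rewrite point-other (i≢j ∘ sym) =
    sym (trans (cong (_- + edges i j) (ℤ.*-zeroˡ (+ val G j))) (ℤ.+-identityˡ (- + edges i j)))

  val≡sum-edges : ∀ i → + val G i ≡ sum (λ j → + edges i j)
  val≡sum-edges i = begin
    + ℤ.∣ Σℤ eᵢ ∣  ≡⟨ cong (+_ ∘ ℤ.∣_∣) (Σℤ≗sum eᵢ) ⟩
    + ℤ.∣ sum eᵢ ∣ ≡⟨ ℤ.0≤i⇒+∣i∣≡i (sum-nonneg {f = eᵢ} (λ _ → +≤+ z≤n)) ⟩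
    sum eᵢ         ∎
    where
    eᵢ : Fin (ℕ.suc n) → ℤ
    eᵢ j = + edges i j

  sum-Laplacian-column : ∀ j → sum (λ i → Laplacian G i j) ≡ 0ℤ
  sum-Laplacian-column j = begin
    sum (λ i → Laplacian G i j)
      ≡⟨ sum-cong-≗ (λ i → Laplacian≡point*val-edges i j) ⟩
    sum (λ i → point j i * + val G j - + edges i j)
      ≡⟨ ∑-distrib-- (λ i → point j i * + val G j) (λ i → + edges i j) ⟩
    sum (λ i → point j i * + val G j) - sum (λ i → + edges i j)
      ≡⟨ cong₂ _-_ (*-distribʳ-sum (+ val G j) (point j)) (sum-cong-≗ (cong +_ ∘ symmetric j)) ⟨
    sum (point j) * + val G j - sum (λ i → + edges j i)
      ≡⟨ cong₂ _-_ (trans (cong (_* + val G j) (sum-point j)) (ℤ.*-identityˡ (+ val G j)))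
                   (sym (val≡sum-edges j)) ⟩
    + val G j - + val G j
      ≡⟨ ℤ.+-inverseʳ (+ val G j) ⟩
    0ℤ ∎

  deg-applyΔ : ∀ z → deg (applyΔ G z) ≡ 0ℤ
  deg-applyΔ z = begin
    deg (applyΔ G z)
      ≡⟨ Σℤ≗sum (applyΔ G z) ⟩
    sum (applyΔ G z)
      ≡⟨ sum-cong-≗ (λ i → Σℤ≗sum (λ j → Laplacian G i j * z j)) ⟩
    sum (λ i → sum (λ j → Laplacian G i j * z j))
      ≡⟨ ∑-comm (λ i j → Laplacian G i j * z j) ⟩
    sum (λ j → sum (λ i → Laplacian G i j * z j))
      ≡⟨ sum-cong-≗ (λ j → *-distribʳ-sum (z j) (λ i → Laplacian G i j)) ⟨
    sum (λ j → sum (λ i → Laplacian G i j) * z j)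
      ≡⟨ sum-cong-≗ (λ j → trans (cong (_* z j) (sum-Laplacian-column j)) (ℤ.*-zeroˡ (z j))) ⟩
    sum {ℕ.suc n} (λ _ → 0ℤ)
      ≡⟨ sum-replicate-zero (ℕ.suc n) ⟩
    0ℤ ∎

  ∼⇒deg≡ : ∀ {D D′} → _∼_ G D D′ → deg D ≡ deg D′
  ∼⇒deg≡ {D} {D′} (z , D-D′≡Δz) = ℤ.i-j≡0⇒i≡j (deg D) (deg D′) (begin
    deg D - deg D′    ≡⟨ deg-⊖ D D′ ⟨
    deg (D ⊖ D′)      ≡⟨ deg-cong D-D′≡Δz ⟩
    deg (applyΔ G z)  ≡⟨ deg-applyΔ z ⟩
    0ℤ                ∎)

  deg-∼-residual : ∀ {D E F : Divisor n} {d r} → deg D ≡ + d → deg E ≡ + r → r ≤ d →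
                   _∼_ G (D ⊖ E) F → deg F ≡ + (d ∸ r)
  deg-∼-residual {D} {E} {F} {d} {r} degD degE r≤d D-E∼F = begin
    deg F          ≡⟨ ∼⇒deg≡ {D ⊖ E} D-E∼F ⟨
    deg (D ⊖ E)    ≡⟨ deg-⊖ D E ⟩
    deg D - deg E  ≡⟨ cong₂ _-_ degD degE ⟩
    + d - + r      ≡⟨ ℤ.m-n≡m⊖n d r ⟩
    d ℤ.⊖ r        ≡⟨ ℤ.⊖-≥ r≤d ⟩
    + (d ∸ r)      ∎

  RankProperty-antitone : ∀ {D r s} → r ≤ s → RankProperty G D s → RankProperty G D r
  RankProperty-antitone {D} {r} {s} r≤s RP E E≥0 degE =
    let (F , F≥0 , D-E-P∼F) = RP (E ⊕ P) (⊕-effective E≥0 P≥0) degE+P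
    in  F ⊕ P , ⊕-effective F≥0 P≥0 ,
        ∼-resp-⊖ (D ⊖ (E ⊕ P)) F (D ⊖ E) (F ⊕ P)
                 (λ i → shift (D i) (E i) (P i) (F i)) D-E-P∼F
    where
    padding : Vec (Fin (ℕ.suc n)) (s ∸ r)
    padding = replicate (s ∸ r) zero
    P : Divisor n
    P = sumPoints padding
    P≥0 : Effective P
    P≥0 = sumPoints-effective padding
    degE+P : deg (E ⊕ P) ≡ + s
    degE+P = begin
      deg (E ⊕ P)        ≡⟨ deg-⊕ E P ⟩
      deg E + deg P      ≡⟨ cong₂ _+_ degE (deg-sumPoints padding) ⟩
      + r + + (s ∸ r)    ≡⟨ ℤ.pos-+ r (s ∸ r) ⟨
      + (r ℕ.+ (s ∸ r))  ≡⟨ cong +_ (ℕ.m+[n∸m]≡n r≤s) ⟩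
      + s                ∎
    shift : ∀ d e p f → d - (e + p) - f ≡ d - e - (f + p)
    shift = solve-∀

  RankAtLeast⇔RankProperty : ∀ D {r} → RankAtLeast G D r ⇔ RankProperty G D r
  RankAtLeast⇔RankProperty D {r} =
    mk⇔ (λ (_ , r≤s , RP) → RankProperty-antitone {D} r≤s RP) (λ RP → r , ℕ.≤-refl , RP)

  sumPoints-∼⇔sumA-∼ : ∀ D {r m d} (as : Vec (Fin (ℕ.suc n)) r) (bs : Vec (Fin (ℕ.suc n)) m) →
                       r ℕ.+ m ≡ d →
                       _∼_ G (D ⊖ sumPoints as) (sumPoints bs) ⇔
                       _∼_ G ((D ⊖ scale (+ d) (point zero)) ⊖ sumA as) (sumA bs)
  sumPoints-∼⇔sumA-∼ D {d = d} as bs r+m≡d = mk⇔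
    (∼-resp-⊖ (D ⊖ sumPoints as) (sumPoints bs) X-as (sumA bs) regroup)
    (∼-resp-⊖ X-as (sumA bs) (D ⊖ sumPoints as) (sumPoints bs) (sym ∘ regroup))
    where
    X-as : Divisor n
    X-as = (D ⊖ scale (+ d) (point zero)) ⊖ sumA as
    regroup : ∀ i → (D ⊖ sumPoints as) i - sumPoints bs i ≡ X-as i - sumA bs i
    regroup = sumA-difference D as bs r+m≡d

  RankProperty⇔MinusSubset : ∀ D {d r} → deg D ≡ + d → r ≤ d →
    RankProperty G D r ⇔ MinusSubset G (D ⊖ scale (+ d) (point zero)) r (d ∸ r)
  RankProperty⇔MinusSubset D {d} {r} degD r≤d = mk⇔ forward backward
    where
    translate : ∀ as bs → _∼_ G (D ⊖ sumPoints as) (sumPoints bs) ⇔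
                          _∼_ G ((D ⊖ scale (+ d) (point zero)) ⊖ sumA as) (sumA bs)
    translate as bs = sumPoints-∼⇔sumA-∼ D as bs (ℕ.m+[n∸m]≡n r≤d)

    forward : RankProperty G D r → MinusSubset G (D ⊖ scale (+ d) (point zero)) r (d ∸ r)
    forward RP as with RP (sumPoints as) (sumPoints-effective as) (deg-sumPoints as)
    ... | F , F≥0 , D-E∼F
        with effective⇒sumPoints (d ∸ r) F≥0
               (deg-∼-residual {D} degD (deg-sumPoints as) r≤d D-E∼F)
    ... | bs , F≗bs = bs , Equivalence.to (translate as bs)
          (∼-resp-⊖ (D ⊖ sumPoints as) F (D ⊖ sumPoints as) (sumPoints bs)
                    (λ i → cong (_-_ (D i - sumPoints as i)) (F≗bs i)) D-E∼F)

    backward : MinusSubset G (D ⊖ scale (+ d) (point zero)) r (d ∸ r) → RankProperty G D r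
    backward MS E E≥0 degE with effective⇒sumPoints r E≥0 degE
    ... | as , E≗as with MS as
    ... | bs , X-as∼bs = sumPoints bs , sumPoints-effective bs ,
          ∼-resp-⊖ (D ⊖ sumPoints as) (sumPoints bs) (D ⊖ E) (sumPoints bs)
                   (λ i → cong (λ e → D i - e - sumPoints bs i) (sym (E≗as i)))
                   (Equivalence.from (translate as bs) X-as∼bs)

proposition2p3 : ∀ {n : ℕ} (G : Graph n) (D : Divisor n) (d r : ℕ) →
    deg D ≡ + d → r ≤ d →
    RankAtLeast G D r ⇔ MinusSubset G (D ⊖ scale (+ d) (point zero)) r (d ∸ r)
proposition2p3 G D d r degD r≤d =
  RankProperty⇔MinusSubset G D degD r≤d ⇔-∘ RankAtLeast⇔RankProperty G D
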